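{- Let $\mathcal{P}$ be a distribution over $[m]$ with probabilities $P(1),\dots,P(m)$, and let $\mathcal{P}^*$ be a distribution over $[m]$ with probabilities $P^*(i)\in\left[\frac{1}{2m},\frac{2}{m}\right]$ for all $i$. Suppose $d_{\mathrm{TV}}(\mathcal{P},\mathcal{P}^*)\ge\varepsilon$. Then, if $i$ is drawn from $\mathcal{P}$ and $j$ is drawn independently from the uniform distribution $\mathcal{U}$ over $[m]$, \[\mathbb{E}_{i\sim\mathcal{P},\,j\sim\mathcal{U}}\left|\frac{P(i)}{P(i)+P(j)}-\frac{P^*(i)}{P^*(i)+P^*(j)}\right|\ge\frac{\varepsilon}{16}.\]
   Context: $d_{\mathrm{TV}}(\mathcal{P},\mathcal{P}^*)=\frac12\sum_{i=1}^m|P(i)-P^*(i)|$.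
   Formalization: The probabilities $P(i)$ and $P^*(i)$ and the parameter $\varepsilon$ are rational. -}

module Defs where

open import Data.Nat as ℕ using (ℕ; zero; suc)
open import Data.Fin using (Fin)
open import Data.Product using (_×_)
open import Data.Integer using (+_)
open import Data.Rational
open import Relation.Nullary using (yes; no)
open import Relation.Binary.PropositionalEquality using (_≡_)

Σ[<_]_ : (m : ℕ) → (Fin m → ℚ) → ℚ
Σ[< zero  ] f = 0ℚ
Σ[< suc m ] f = f Fin.zero + Σ[< m ] (λ i → f (Fin.suc i))

IsDistribution : (m : ℕ) → (Fin m → ℚ) → Set
IsDistribution m P = (∀ i → 0ℚ ≤ P i) × (Σ[< m ] P ≡ 1ℚ)

dTV : (m : ℕ) → (Fin m → ℚ) → (Fin m → ℚ) → ℚ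
dTV m P Q = ½ * Σ[< m ] (λ i → ∣ P i - Q i ∣)

-- a / (a + b); convention: 0 when a + b = 0 (only occurs with weight P(i) = 0).
ratio : ℚ → ℚ → ℚ
ratio a b with a + b ≟ 0ℚ
... | yes _ = 0ℚ
... | no ne = _÷_ a (a + b) {{≢-nonZero ne}}

expectedGap : (m : ℕ) .{{_ : ℕ.NonZero m}} → (Fin m → ℚ) → (Fin m → ℚ) → ℚ
expectedGap m P Q =
  Σ[< m ] (λ i → Σ[< m ] (λ j →
    P i * (+ 1 / m) * ∣ ratio (P i) (P j) - ratio (Q i) (Q j) ∣))

{-# OPTIONS --safe #-}
module Submission where

-- For a, b, c, d ≥ 0, clearing denominators gives
--   (b + d) (a |a/(a+c) − b/(b+d)| + c |c/(a+c) − d/(b+d)|) = |ad − bc|.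
-- With a, c = P(i), P(j) and b, d = P*(i), P*(j) ≤ 2/m, the (i, j) and (j, i) terms
-- P(i) |P(i)/(P(i)+P(j)) − P*(i)/(P*(i)+P*(j))| of the expectation (before its factor 1/m)
-- therefore add up to at least (m/4) |P(i) P*(j) − P*(i) P(j)|.  As both distributions sum
-- to 1, these cross differences sum over j to P(i) − P*(i), so by the triangle inequality
-- the expectation is at least d_TV/4.

open import Defs
open import Data.Nat as ℕ using (ℕ)
open import Data.Fin using (Fin)
open import Data.Integer using (+_)
open import Data.Rational

open import Algebra.Bundles using (CommutativeRing)
open import Data.Fin using (zero; suc)
import Data.Integer as ℤ
open import Data.Integer.Tactic.RingSolver using (solve-∀)
open import Data.Product using (_,_)
open import Data.Rational.Properties
open import Data.Rational.Solver using (module +-*-Solver)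
import Data.Rational.Unnormalised as ℚᵘ
import Data.Rational.Unnormalised.Properties as ℚᵘ
open import Data.Unit using (tt)
open import Data.Vec.Functional using (Vector)
open import Function using (_∘_)
open import Relation.Binary.PropositionalEquality
open import Relation.Nullary using (Dec; yes; no; contradiction)

open import Algebra.Properties.Semiring.Sum (CommutativeRing.semiring +-*-commutativeRing)
  using (sum; sum-syntax; sum-cong-≗; sum-replicate-zero; ∑-distrib-+; ∑-comm; *-distribˡ-sum)
open +-*-Solver using (solve; _:+_; _:-_; _:*_; :-_; con; _:=_)

Σ[<]≡sum : ∀ m (f : Fin m → ℚ) → Σ[< m ] f ≡ sum f
Σ[<]≡sum ℕ.zero    f = refl
Σ[<]≡sum (ℕ.suc m) f = cong (_+_ (f zero)) (Σ[<]≡sum m (f ∘ suc))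

sum-mono-≤ : ∀ {n} {f g : Vector ℚ n} → (∀ i → f i ≤ g i) → sum f ≤ sum g
sum-mono-≤ {ℕ.zero}  _   = ≤-refl
sum-mono-≤ {ℕ.suc n} f≤g = +-mono-≤ (f≤g zero) (sum-mono-≤ (f≤g ∘ suc))

sum-nonNeg : ∀ {n} {f : Vector ℚ n} → (∀ i → 0ℚ ≤ f i) → 0ℚ ≤ sum f
sum-nonNeg {n} {f} 0≤f = subst (_≤ sum f) (sum-replicate-zero n) (sum-mono-≤ 0≤f)

∣sum∣≤sum∣∣ : ∀ {n} (f : Vector ℚ n) → ∣ sum f ∣ ≤ ∑[ i < n ] ∣ f i ∣
∣sum∣≤sum∣∣ {ℕ.zero}  f = ≤-refl
∣sum∣≤sum∣∣ {ℕ.suc n} f =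
  ≤-trans (∣p+q∣≤∣p∣+∣q∣ (f zero) _) (+-monoʳ-≤ ∣ f zero ∣ (∣sum∣≤sum∣∣ (f ∘ suc)))

*-distribˡ-∑∑ : ∀ {n} c (f : Fin n → Fin n → ℚ) →
  c * ∑[ i < n ] ∑[ j < n ] f i j ≡ ∑[ i < n ] ∑[ j < n ] (c * f i j)
*-distribˡ-∑∑ {n} c f =
  trans (*-distribˡ-sum c (λ i → ∑[ j < n ] f i j)) (sum-cong-≗ (λ i → *-distribˡ-sum c (f i)))

∑∑-symmetrise : ∀ {n} (f : Fin n → Fin n → ℚ) →
  ∑[ i < n ] ∑[ j < n ] (f i j + f j i) ≡ ∑[ i < n ] ∑[ j < n ] f i j + ∑[ i < n ] ∑[ j < n ] f i j
∑∑-symmetrise {n} f = begin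
  ∑[ i < n ] ∑[ j < n ] (f i j + f j i)
    ≡⟨ sum-cong-≗ (λ i → ∑-distrib-+ (f i) (λ j → f j i)) ⟩
  ∑[ i < n ] (∑[ j < n ] f i j + ∑[ j < n ] f j i)
    ≡⟨ ∑-distrib-+ (λ i → ∑[ j < n ] f i j) (λ i → ∑[ j < n ] f j i) ⟩
  ∑∑f + ∑[ i < n ] ∑[ j < n ] f j i
    ≡⟨ cong (_+_ ∑∑f) (∑-comm (λ i j → f j i)) ⟩
  ∑∑f + ∑∑f
    ∎
  where
  open ≡-Reasoning
  ∑∑f : ℚ
  ∑∑f = ∑[ i < n ] ∑[ j < n ] f i j

∑-cross : ∀ {n} p q (f g : Vector ℚ n) → ∑[ j < n ] (p * f j - q * g j) ≡ p * sum f - q * sum g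
∑-cross {n} p q f g = begin
  ∑[ j < n ] (p * f j - q * g j)                  ≡⟨ ∑-distrib-+ (λ j → p * f j) (λ j → - (q * g j)) ⟩
  ∑[ j < n ] (p * f j) + ∑[ j < n ] (- (q * g j)) ≡⟨ cong₂ _+_ (sym (*-distribˡ-sum p f))
                                                     (sum-cong-≗ (λ j → neg-distribˡ-* q (g j))) ⟩
  p * sum f + ∑[ j < n ] (- q * g j)              ≡⟨ cong (_+_ (p * sum f)) (sym (*-distribˡ-sum (- q) g)) ⟩
  p * sum f + - q * sum g                         ≡⟨ cong (_+_ (p * sum f)) (sym (neg-distribˡ-* q (sum g))) ⟩
  p * sum f - q * sum g                           ∎
  where open ≡-Reasoning

0≤p*q : ∀ {p q} → 0ℚ ≤ p → 0ℚ ≤ q → 0ℚ ≤ p * q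
0≤p*q {p} {q} 0≤p 0≤q =
  nonNegative⁻¹ (p * q) {{nonNeg*nonNeg⇒nonNeg p {{nonNegative 0≤p}} q {{nonNegative 0≤q}}}}

p+q≡0⇒p≡0 : ∀ {p q} → 0ℚ ≤ p → 0ℚ ≤ q → p + q ≡ 0ℚ → p ≡ 0ℚ
p+q≡0⇒p≡0 {p} {q} 0≤p 0≤q p+q≡0 = ≤-antisym (begin
  p        ≡⟨ +-identityʳ p ⟨
  p + 0ℚ   ≤⟨ +-monoʳ-≤ p 0≤q ⟩
  p + q    ≡⟨ p+q≡0 ⟩
  0ℚ       ∎) 0≤p
  where open ≤-Reasoning

p+q≡0⇒q≡0 : ∀ {p q} → 0ℚ ≤ p → 0ℚ ≤ q → p + q ≡ 0ℚ → q ≡ 0ℚ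
p+q≡0⇒q≡0 {p} {q} 0≤p 0≤q p+q≡0 = p+q≡0⇒p≡0 0≤q 0≤p (trans (+-comm q p) p+q≡0)

*-cancelˡ-≡ : ∀ r .{{_ : NonZero r}} {p q} → r * p ≡ r * q → p ≡ q
*-cancelˡ-≡ r {p} {q} rp≡rq = begin
  p                ≡⟨ sym (*-identityˡ p) ⟩
  1ℚ * p           ≡⟨ cong (_* p) (sym (*-inverseˡ r)) ⟩
  (1/ r) * r * p   ≡⟨ *-assoc (1/ r) r p ⟩
  (1/ r) * (r * p) ≡⟨ cong (1/ r *_) rp≡rq ⟩
  (1/ r) * (r * q) ≡⟨ *-assoc (1/ r) r q ⟨
  (1/ r) * r * q   ≡⟨ cong (_* q) (*-inverseˡ r) ⟩
  1ℚ * q           ≡⟨ *-identityˡ q ⟩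
  q                ∎
  where open ≡-Reasoning

-- _/_ normalises, so the identity is checked on the unnormalised representatives.
/-distrib-+ : ∀ (i j : ℤ.ℤ) d .{{_ : ℕ.NonZero d}} → (i ℤ.+ j) / d ≡ i / d + j / d
/-distrib-+ i j (ℕ.suc k) = toℚᵘ-injective (begin
  toℚᵘ ((i ℤ.+ j) / ℕ.suc k)                  ≈⟨ toℚᵘ-fromℚᵘ (ℚᵘ.mkℚᵘ (i ℤ.+ j) k) ⟩
  ℚᵘ.mkℚᵘ (i ℤ.+ j) k                         ≈⟨ ℚᵘ.*≡* (common-denominator i j (+ ℕ.suc k)) ⟩
  ℚᵘ.mkℚᵘ i k ℚᵘ.+ ℚᵘ.mkℚᵘ j k                ≈⟨ ℚᵘ.+-cong (toℚᵘ-fromℚᵘ (ℚᵘ.mkℚᵘ i k)) (toℚᵘ-fromℚᵘ (ℚᵘ.mkℚᵘ j k)) ⟨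
  toℚᵘ (i / ℕ.suc k) ℚᵘ.+ toℚᵘ (j / ℕ.suc k)  ≈⟨ toℚᵘ-homo-+ (i / ℕ.suc k) (j / ℕ.suc k) ⟨
  toℚᵘ (i / ℕ.suc k + j / ℕ.suc k)            ∎)
  where
  open import Relation.Binary.Reasoning.Setoid ℚᵘ.≃-setoid
  common-denominator : ∀ i j d → (i ℤ.+ j) ℤ.* (d ℤ.* d) ≡ (i ℤ.* d ℤ.+ j ℤ.* d) ℤ.* d
  common-denominator = solve-∀

ratio-cancel : ∀ {a b} → a + b ≢ 0ℚ → (a + b) * ratio a b ≡ a
ratio-cancel {a} {b} a+b≢0 with a + b ≟ 0ℚ
... | yes a+b≡0 = contradiction a+b≡0 a+b≢0
... | no  _ = begin
  (a + b) * (a * (1/ (a + b)))   ≡⟨ solve 3 (λ s a i → s :* (a :* i) := a :* (s :* i))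
                                            refl (a + b) a (1/ (a + b)) ⟩
  a * ((a + b) * (1/ (a + b)))   ≡⟨ cong (a *_) (*-inverseʳ (a + b)) ⟩
  a * 1ℚ                         ≡⟨ *-identityʳ a ⟩
  a                              ∎
  where
  open ≡-Reasoning
  instance
    a+b-nonZero : NonZero (a + b)
    a+b-nonZero = ≢-nonZero a+b≢0

ratio-unique : ∀ {a b r} → a + b ≢ 0ℚ → (a + b) * r ≡ a → ratio a b ≡ r
ratio-unique {a} {b} a+b≢0 [a+b]r≡a =
  *-cancelˡ-≡ (a + b) {{≢-nonZero a+b≢0}} (trans (ratio-cancel a+b≢0) (sym [a+b]r≡a))

ratio-swap : ∀ {a b} → a + b ≢ 0ℚ → ratio b a ≡ 1ℚ - ratio a b
ratio-swap {a} {b} a+b≢0 = ratio-unique (a+b≢0 ∘ trans (+-comm a b)) (begin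
  (b + a) * (1ℚ - ratio a b)       ≡⟨ solve 3 (λ a b r → (b :+ a) :* (con 1ℚ :- r) := (b :+ a) :- (a :+ b) :* r)
                                            refl a b (ratio a b) ⟩
  (b + a) - (a + b) * ratio a b    ≡⟨ cong (λ t → (b + a) - t) (ratio-cancel a+b≢0) ⟩
  (b + a) - a                      ≡⟨ solve 2 (λ a b → (b :+ a) :- a := b) refl a b ⟩
  b                                ∎)
  where open ≡-Reasoning

ratio-sub-cross : ∀ a b c d → a + c ≢ 0ℚ → b + d ≢ 0ℚ →
  (a + c) * (b + d) * (ratio a c - ratio b d) ≡ a * d - b * c
ratio-sub-cross a b c d a+c≢0 b+d≢0 = begin
  (a + c) * (b + d) * (ratio a c - ratio b d)
    ≡⟨ solve 6 (λ a b c d r s → (a :+ c) :* (b :+ d) :* (r :- s) :=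
                               (b :+ d) :* ((a :+ c) :* r) :- (a :+ c) :* ((b :+ d) :* s))
             refl a b c d (ratio a c) (ratio b d) ⟩
  (b + d) * ((a + c) * ratio a c) - (a + c) * ((b + d) * ratio b d)
    ≡⟨ cong₂ (λ x y → (b + d) * x - (a + c) * y) (ratio-cancel a+c≢0) (ratio-cancel b+d≢0) ⟩
  (b + d) * a - (a + c) * b
    ≡⟨ solve 4 (λ a b c d → (b :+ d) :* a :- (a :+ c) :* b := a :* d :- b :* c) refl a b c d ⟩
  a * d - b * c
    ∎
  where open ≡-Reasoning

ratio-gap-cross-nonDegenerate : ∀ a b c d → 0ℚ ≤ a + c → 0ℚ ≤ b + d → a + c ≢ 0ℚ → b + d ≢ 0ℚ →
  (b + d) * (a * ∣ ratio a c - ratio b d ∣ + c * ∣ ratio c a - ratio d b ∣) ≡ ∣ a * d - b * c ∣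
ratio-gap-cross-nonDegenerate a b c d 0≤a+c 0≤b+d a+c≢0 b+d≢0 = begin
  (b + d) * (a * ∣ x ∣ + c * ∣ ratio c a - ratio d b ∣)
    ≡⟨ cong (λ t → (b + d) * (a * ∣ x ∣ + c * t)) (trans (cong ∣_∣ swapped≡-x) (∣-p∣≡∣p∣ x)) ⟩
  (b + d) * (a * ∣ x ∣ + c * ∣ x ∣)
    ≡⟨ solve 5 (λ a b c d x → (b :+ d) :* (a :* x :+ c :* x) := (a :+ c) :* (b :+ d) :* x) refl a b c d ∣ x ∣ ⟩
  (a + c) * (b + d) * ∣ x ∣
    ≡⟨ cong (_* ∣ x ∣) (0≤p⇒∣p∣≡p (0≤p*q 0≤a+c 0≤b+d)) ⟨
  ∣ (a + c) * (b + d) ∣ * ∣ x ∣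
    ≡⟨ ∣p*q∣≡∣p∣*∣q∣ ((a + c) * (b + d)) x ⟨
  ∣ (a + c) * (b + d) * x ∣
    ≡⟨ cong ∣_∣ (ratio-sub-cross a b c d a+c≢0 b+d≢0) ⟩
  ∣ a * d - b * c ∣
    ∎
  where
  open ≡-Reasoning
  x : ℚ
  x = ratio a c - ratio b d
  swapped≡-x : ratio c a - ratio d b ≡ - x
  swapped≡-x = begin
    ratio c a - ratio d b               ≡⟨ cong₂ _-_ (ratio-swap {a} {c} a+c≢0) (ratio-swap {b} {d} b+d≢0) ⟩
    (1ℚ - ratio a c) - (1ℚ - ratio b d) ≡⟨ solve 2 (λ r s → (con 1ℚ :- r) :- (con 1ℚ :- s) := :- (r :- s))
                                                 refl (ratio a c) (ratio b d) ⟩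
    - x                                 ∎

ratio-gap-cross : ∀ {a b c d} → 0ℚ ≤ a → 0ℚ ≤ b → 0ℚ ≤ c → 0ℚ ≤ d →
  (b + d) * (a * ∣ ratio a c - ratio b d ∣ + c * ∣ ratio c a - ratio d b ∣) ≡ ∣ a * d - b * c ∣
ratio-gap-cross {a} {b} {c} {d} 0≤a 0≤b 0≤c 0≤d = cases (a + c ≟ 0ℚ) (b + d ≟ 0ℚ)
  where
  cases : Dec (a + c ≡ 0ℚ) → Dec (b + d ≡ 0ℚ) →
    (b + d) * (a * ∣ ratio a c - ratio b d ∣ + c * ∣ ratio c a - ratio d b ∣) ≡ ∣ a * d - b * c ∣
  -- If a + c = 0 or b + d = 0 both sides vanish, whatever ratio returns there.
  cases (yes a+c≡0) _
    rewrite p+q≡0⇒p≡0 0≤a 0≤c a+c≡0 | p+q≡0⇒q≡0 0≤a 0≤c a+c≡0 =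
    trans (solve 4 (λ b d x y → (b :+ d) :* (con 0ℚ :* x :+ con 0ℚ :* y) := con 0ℚ) refl
            b d ∣ ratio 0ℚ 0ℚ - ratio b d ∣ ∣ ratio 0ℚ 0ℚ - ratio d b ∣)
          (cong ∣_∣ (solve 2 (λ b d → con 0ℚ := con 0ℚ :* d :- b :* con 0ℚ) refl b d))
  cases _ (yes b+d≡0)
    rewrite p+q≡0⇒p≡0 0≤b 0≤d b+d≡0 | p+q≡0⇒q≡0 0≤b 0≤d b+d≡0 =
    trans (solve 2 (λ x y → (con 0ℚ :+ con 0ℚ) :* (x :+ y) := con 0ℚ) refl
            (a * ∣ ratio a c - ratio 0ℚ 0ℚ ∣) (c * ∣ ratio c a - ratio 0ℚ 0ℚ ∣))
          (cong ∣_∣ (solve 2 (λ a c → con 0ℚ := a :* con 0ℚ :- con 0ℚ :* c) refl a c))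
  cases (no a+c≢0) (no b+d≢0) =
    ratio-gap-cross-nonDegenerate a b c d (+-mono-≤ 0≤a 0≤c) (+-mono-≤ 0≤b 0≤d) a+c≢0 b+d≢0

weightedRatioGap : ∀ {n} → Vector ℚ n → Vector ℚ n → Fin n → Fin n → ℚ
weightedRatioGap P Q i j = P i * ∣ ratio (P i) (P j) - ratio (Q i) (Q j) ∣

∣cross∣≤weightedRatioGap : ∀ {n} (P Q : Vector ℚ n) {β} → (∀ i → 0ℚ ≤ P i) → (∀ i → 0ℚ ≤ Q i) →
  (∀ i → Q i ≤ β) → ∀ i j →
  ∣ P i * Q j - Q i * P j ∣ ≤ (β + β) * (weightedRatioGap P Q i j + weightedRatioGap P Q j i)
∣cross∣≤weightedRatioGap P Q {β} 0≤P 0≤Q Q≤β i j = begin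
  ∣ P i * Q j - Q i * P j ∣ ≡⟨ ratio-gap-cross (0≤P i) (0≤Q i) (0≤P j) (0≤Q j) ⟨
  (Q i + Q j) * g           ≤⟨ *-monoʳ-≤-nonNeg g {{nonNegative 0≤g}} (+-mono-≤ (Q≤β i) (Q≤β j)) ⟩
  (β + β) * g               ∎
  where
  open ≤-Reasoning
  g : ℚ
  g = weightedRatioGap P Q i j + weightedRatioGap P Q j i
  0≤g : 0ℚ ≤ g
  0≤g = +-mono-≤ (0≤p*q (0≤P i) (0≤∣p∣ _)) (0≤p*q (0≤P j) (0≤∣p∣ _))

∑∣p-q∣≤∑∑∣cross∣ : ∀ {n} (P Q : Vector ℚ n) → sum P ≡ 1ℚ → sum Q ≡ 1ℚ →
  ∑[ i < n ] ∣ P i - Q i ∣ ≤ ∑[ i < n ] ∑[ j < n ] ∣ P i * Q j - Q i * P j ∣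
∑∣p-q∣≤∑∑∣cross∣ {n} P Q ∑P≡1 ∑Q≡1 = sum-mono-≤ λ i → begin
  ∣ P i - Q i ∣                             ≡⟨ cong₂ (λ s t → ∣ s - t ∣) (*-identityʳ (P i)) (*-identityʳ (Q i)) ⟨
  ∣ P i * 1ℚ - Q i * 1ℚ ∣                   ≡⟨ cong₂ (λ s t → ∣ P i * s - Q i * t ∣) ∑Q≡1 ∑P≡1 ⟨
  ∣ P i * sum Q - Q i * sum P ∣             ≡⟨ cong ∣_∣ (∑-cross (P i) (Q i) Q P) ⟨
  ∣ ∑[ j < n ] (P i * Q j - Q i * P j) ∣    ≤⟨ ∣sum∣≤sum∣∣ (λ j → P i * Q j - Q i * P j) ⟩
  ∑[ j < n ] ∣ P i * Q j - Q i * P j ∣      ∎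
  where open ≤-Reasoning

∑∣p-q∣≤∑∑weightedRatioGap : ∀ {n} (P Q : Vector ℚ n) {β} → (∀ i → 0ℚ ≤ P i) → (∀ i → 0ℚ ≤ Q i) →
  sum P ≡ 1ℚ → sum Q ≡ 1ℚ → (∀ i → Q i ≤ β) →
  ∑[ i < n ] ∣ P i - Q i ∣ ≤
    (β + β) * (∑[ i < n ] ∑[ j < n ] weightedRatioGap P Q i j + ∑[ i < n ] ∑[ j < n ] weightedRatioGap P Q i j)
∑∣p-q∣≤∑∑weightedRatioGap {n} P Q {β} 0≤P 0≤Q ∑P≡1 ∑Q≡1 Q≤β = begin
  ∑[ i < n ] ∣ P i - Q i ∣
    ≤⟨ ∑∣p-q∣≤∑∑∣cross∣ P Q ∑P≡1 ∑Q≡1 ⟩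
  ∑[ i < n ] ∑[ j < n ] ∣ P i * Q j - Q i * P j ∣
    ≤⟨ sum-mono-≤ (λ i → sum-mono-≤ (∣cross∣≤weightedRatioGap P Q 0≤P 0≤Q Q≤β i)) ⟩
  ∑[ i < n ] ∑[ j < n ] ((β + β) * (g i j + g j i))
    ≡⟨ *-distribˡ-∑∑ (β + β) (λ i j → g i j + g j i) ⟨
  (β + β) * ∑[ i < n ] ∑[ j < n ] (g i j + g j i)
    ≡⟨ cong ((β + β) *_) (∑∑-symmetrise g) ⟩
  (β + β) * (∑[ i < n ] ∑[ j < n ] g i j + ∑[ i < n ] ∑[ j < n ] g i j)
    ∎
  where
  open ≤-Reasoning
  g : Fin n → Fin n → ℚ
  g = weightedRatioGap P Q

expectedGap≡∑∑weightedRatioGap : ∀ m .{{_ : ℕ.NonZero m}} (P Q : Fin m → ℚ) →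
  expectedGap m P Q ≡ (+ 1 / m) * ∑[ i < m ] ∑[ j < m ] weightedRatioGap P Q i j
expectedGap≡∑∑weightedRatioGap m P Q = begin
  expectedGap m P Q
    ≡⟨ trans (Σ[<]≡sum m (λ i → Σ[< m ] (term i))) (sum-cong-≗ (λ i → Σ[<]≡sum m (term i))) ⟩
  ∑[ i < m ] ∑[ j < m ] term i j
    ≡⟨ sum-cong-≗ (λ i → sum-cong-≗ (λ j →
         solve 3 (λ p w r → p :* w :* r := w :* (p :* r)) refl (P i) w (gap i j))) ⟩
  ∑[ i < m ] ∑[ j < m ] (w * weightedRatioGap P Q i j)
    ≡⟨ *-distribˡ-∑∑ w (weightedRatioGap P Q) ⟨
  w * ∑[ i < m ] ∑[ j < m ] weightedRatioGap P Q i j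
    ∎
  where
  open ≡-Reasoning
  w : ℚ
  w = + 1 / m
  gap term : Fin m → Fin m → ℚ
  gap i j = ∣ ratio (P i) (P j) - ratio (Q i) (Q j) ∣
  term i j = P i * w * gap i j

0≤dTV : ∀ m (P Q : Fin m → ℚ) → 0ℚ ≤ dTV m P Q
0≤dTV m P Q = 0≤p*q {½} (≤ᵇ⇒≤ tt)
  (subst (0ℚ ≤_) (sym (Σ[<]≡sum m (λ i → ∣ P i - Q i ∣))) (sum-nonNeg (λ i → 0≤∣p∣ (P i - Q i))))

dTV*¼≤expectedGap : ∀ m .{{_ : ℕ.NonZero m}} (P Q : Fin m → ℚ) →
  IsDistribution m P → IsDistribution m Q → (∀ i → Q i ≤ + 2 / m) →
  dTV m P Q * (+ 1 / 4) ≤ expectedGap m P Q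
dTV*¼≤expectedGap m P Q (0≤P , ΣP≡1) (0≤Q , ΣQ≡1) Q≤2/m = begin
  dTV m P Q * (+ 1 / 4)
    ≡⟨ cong (λ s → ½ * s * (+ 1 / 4)) (Σ[<]≡sum m (λ i → ∣ P i - Q i ∣)) ⟩
  ½ * S * (+ 1 / 4)
    ≡⟨ solve 1 (λ s → con ½ :* s :* con (+ 1 / 4) := s :* con (+ 1 / 8)) refl S ⟩
  S * (+ 1 / 8)
    ≤⟨ *-monoʳ-≤-nonNeg (+ 1 / 8) (∑∣p-q∣≤∑∑weightedRatioGap P Q 0≤P 0≤Q ∑P≡1 ∑Q≡1 Q≤w+w) ⟩
  ((w + w) + (w + w)) * (G + G) * (+ 1 / 8)
    ≡⟨ solve 2 (λ w G → ((w :+ w) :+ (w :+ w)) :* (G :+ G) :* con (+ 1 / 8) := w :* G) refl w G ⟩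
  w * G
    ≡⟨ expectedGap≡∑∑weightedRatioGap m P Q ⟨
  expectedGap m P Q
    ∎
  where
  open ≤-Reasoning
  w S G : ℚ
  w = + 1 / m
  S = ∑[ i < m ] ∣ P i - Q i ∣
  G = ∑[ i < m ] ∑[ j < m ] weightedRatioGap P Q i j
  ∑P≡1 : sum P ≡ 1ℚ
  ∑P≡1 = trans (sym (Σ[<]≡sum m P)) ΣP≡1
  ∑Q≡1 : sum Q ≡ 1ℚ
  ∑Q≡1 = trans (sym (Σ[<]≡sum m Q)) ΣQ≡1
  Q≤w+w : ∀ i → Q i ≤ w + w
  Q≤w+w i = ≤-trans (Q≤2/m i) (≤-reflexive (/-distrib-+ (+ 1) (+ 1) m))

lemma7p1 : (m : ℕ) .{{_ : ℕ.NonZero m}} (P Pstar : Fin m → ℚ) (ε : ℚ) →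
    IsDistribution m P → IsDistribution m Pstar →
    (∀ i → ½ * (+ 1 / m) ≤ Pstar i) → (∀ i → Pstar i ≤ + 2 / m) →
    ε ≤ dTV m P Pstar →
    ε * (+ 1 / 16) ≤ expectedGap m P Pstar
lemma7p1 m P Pstar ε P-dist Pstar-dist _ Pstar≤2/m ε≤dTV = begin
  ε * (+ 1 / 16)             ≤⟨ *-monoʳ-≤-nonNeg (+ 1 / 16) ε≤dTV ⟩
  dTV m P Pstar * (+ 1 / 16) ≤⟨ *-monoˡ-≤-nonNeg (dTV m P Pstar) {{nonNegative (0≤dTV m P Pstar)}} (≤ᵇ⇒≤ tt) ⟩
  dTV m P Pstar * (+ 1 / 4)  ≤⟨ dTV*¼≤expectedGap m P Pstar P-dist Pstar-dist Pstar≤2/m ⟩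
  expectedGap m P Pstar      ∎
  where open ≤-Reasoning
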